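{- Let $R$ be a normal CTRS over $\mathcal{F}$ and let $R'=\{l\to r\Leftarrow s_1\downarrow n_1;\dots;s_k\downarrow n_k\mid l\to r\Leftarrow s_1\twoheadrightarrow n_1;\dots;s_k\twoheadrightarrow n_k\in R\}$ be the corresponding join CTRS. If $\mathbb{U}_{\mathrm{J}}$ is sound for $R'$, then $\mathbb{U}_{\mathrm{N}}$ is sound for $R$; and if $\mathbb{U}_{\mathrm{J}}$ is sound for $R'$ w.r.t. EV-safe reduction of $\mathbb{U}_{\mathrm{J}}(R')$, then $\mathbb{U}_{\mathrm{N}}$ is sound for $R$ w.r.t. EV-safe reduction of $\mathbb{U}_{\mathrm{N}}(R)$.
   Context: Terms $T(\mathcal{F},\mathcal{V})$, $\mathrm{Var}(\cdot)$ variables occurring, $\mathrm{Pos}_{\mathcal{F}}$/$\mathrm{Pos}_{\mathcal{V}}$ function-symbol/variable positions, $t|_p$ subterm, $p\le q$ prefix order. An oriented conditional rule $l\to r\Leftarrow s_1\twoheadrightarrow t_1;\dots;s_k\twoheadrightarrow t_k$ and a join rule $l\to r\Leftarrow s_1\downarrow t_1;\dots;s_k\downarrow t_k$ have $l\notin\mathcal{V}$. Rewrite relation of a rule set $R$: $\to_R=\bigcup_n\to_{(n),R}$, $\to_{(0),R}=\emptyset$, $\to_{(i+1),R}=\{(C[l\sigma],C[r\sigma])\mid \text{each condition holds for }\sigma\text{ w.r.t. }\to_{(i),R}\}$, where $s\twoheadrightarrow t$ holds if $s\sigma\to^*_{(i),R}t\sigma$ and $s\downarrow t$ holds if $s\sigma$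 and $t\sigma$ have a common $\to^*_{(i),R}$-reduct. $R_u=\{l\to r\mid l\to r\Leftarrow c\in R\}$. A normal CTRS is a set of oriented rules with $\mathrm{Var}(s_i)\subseteq\mathrm{Var}(l)$ in which each $t_i$ (written $n_i$) is a ground normal form w.r.t. $R_u$. $\overrightarrow{\mathrm{Var}(l)}$ is a fixed listing of $\mathrm{Var}(l)$. $\mathbb{U}_{\mathrm{N}}(\rho)=\{l\to U^\rho(s_1,\dots,s_k,\overrightarrow{\mathrm{Var}(l)}),\ U^\rho(n_1,\dots,n_k,\overrightarrow{\mathrm{Var}(l)})\to r\}$ for oriented rules with $k\ge1$ and fresh $U^\rho$; $\mathbb{U}_{\mathrm{J}}(\rho)=\{l\to U^\rho(s_1,t_1,\dots,s_k,t_k,\overrightarrow{\mathrm{Var}(l)}),\ U^\rho(x_1,x_1,\dots,x_k,x_k,\overrightarrow{\mathrm{Var}(l)})\to r\}$ for join rules with $k\ge1$, fresh $U^\rho$ and fresh distinct variables $x_i$; unconditional rules kept; both extended by union. A transformation $U$ is sound for $R$ over $\mathcal{F}$ if $s\to^*_{U(R)}t$ implies $s\to^*_Rt$ for all $s,t\in T(\mathcal{F},\mathcal{V})$, and sound w.r.t. EV-safe reduction if $s\to^*_{\mathrm{evs},U(R)}t$ implies $s\to^*_Rt$ for all such $s,t$. EV-safe reduction of an unconditional system $S$: for $t_0\to_{p_1,l_1\to r_1}t_1\to\cdots$ let $B_0=\mathrm{Pos}_{\mathcal{F}}(t_0)$, $B_i=(B_{i-1}\setminus\{q\in B_{i-1}\mid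 q\ge p_i\})\cup\{p_iq\mid q\in\mathrm{Pos}_{\mathcal{F}}(r_i)\}\cup\{p_ip'q\mid p_ipq\in B_{i-1},p\in\mathrm{Pos}_{\mathcal{V}}(l_i),l_i|_p=r_i|_{p'}\}$; EV-safe if $p_i\in B_{i-1}$ for all $i$; $\to^*_{\mathrm{evs},S}$: a finite EV-safe sequence exists. -}

module Defs where

open import Data.Nat using (ℕ; zero; suc; _+_; _⊔_)
open import Data.Nat.Properties using (_≟_)
open import Data.List using (List; []; _∷_; _++_; length; deduplicate; foldr)
import Data.List as L
open import Data.List.Membership.Propositional using (_∈_)
open import Data.List.Relation.Unary.All using (All)
open import Data.Vec using (Vec; []; _∷_; fromList) renaming (_++_ to _++ᵥ_; map to mapᵥ)
open import Data.Maybe using (Maybe; just; nothing)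
open import Data.Product using (∃; ∃-syntax; _×_; _,_)
open import Data.Sum using (_⊎_; inj₁; inj₂; [_,_])
open import Data.Empty using (⊥)
open import Function using (_∘_)
open import Relation.Nullary using (¬_)
open import Relation.Binary.PropositionalEquality using (_≡_; _≢_)
open import Relation.Binary.Construct.Closure.ReflexiveTransitive using (Star)

record Signature : Set₁ where
  constructor sig
  field
    Sym : Set
    ar  : Sym → ℕ
open Signature public

data Term (𝓕 : Signature) : Set where
  var : ℕ → Term 𝓕
  fun : (f : Sym 𝓕) → Vec (Term 𝓕) (ar 𝓕 f) → Term 𝓕

Subst : Signature → Set
Subst 𝓕 = ℕ → Term 𝓕

-- positions: sequences of argument indices (0-based)
Pos : Set
Pos = List ℕ

PosSet : Set₁
PosSet = Pos → Set

_≼_ : Pos → Pos → Set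
p ≼ q = ∃[ r ] q ≡ p ++ r

module _ {𝓕 : Signature} where

  mutual
    _⟨_⟩ : Term 𝓕 → Subst 𝓕 → Term 𝓕
    var x ⟨ σ ⟩ = σ x
    fun f ts ⟨ σ ⟩ = fun f (substs ts σ)

    substs : ∀ {n} → Vec (Term 𝓕) n → Subst 𝓕 → Vec (Term 𝓕) n
    substs [] σ = []
    substs (t ∷ ts) σ = (t ⟨ σ ⟩) ∷ substs ts σ

  mutual
    _at_ : Term 𝓕 → Pos → Maybe (Term 𝓕)
    t at [] = just t
    var x at (i ∷ p) = nothing
    fun f ts at (i ∷ p) = atArgs ts i p

    atArgs : ∀ {n} → Vec (Term 𝓕) n → ℕ → Pos → Maybe (Term 𝓕)
    atArgs [] i p = nothing
    atArgs (t ∷ ts) zero p = t at p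
    atArgs (t ∷ ts) (suc i) p = atArgs ts i p

  mutual
    _[_≔_] : Term 𝓕 → Pos → Term 𝓕 → Term 𝓕
    t [ [] ≔ u ] = u
    var x [ i ∷ p ≔ u ] = var x
    fun f ts [ i ∷ p ≔ u ] = fun f (replArgs ts i p u)

    replArgs : ∀ {n} → Vec (Term 𝓕) n → ℕ → Pos → Term 𝓕 → Vec (Term 𝓕) n
    replArgs [] i p u = []
    replArgs (t ∷ ts) zero p u = (t [ p ≔ u ]) ∷ ts
    replArgs (t ∷ ts) (suc i) p u = t ∷ replArgs ts i p u

  -- variable occurrences (left to right, with repetitions); Var(t) = membership
  mutual
    varsOf : Term 𝓕 → List ℕ
    varsOf (var x) = x ∷ []
    varsOf (fun f ts) = varsArgs ts

    varsArgs : ∀ {n} → Vec (Term 𝓕) n → List ℕ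
    varsArgs [] = []
    varsArgs (t ∷ ts) = varsOf t ++ varsArgs ts

  -- the fixed listing of Var(t): first occurrences, left to right
  varList : Term 𝓕 → List ℕ
  varList t = deduplicate _≟_ (varsOf t)

  PosF : Term 𝓕 → PosSet
  PosF t p = ∃[ f ] ∃[ ts ] (t at p ≡ just (fun f ts))

  PosV : Term 𝓕 → PosSet
  PosV t p = ∃[ x ] (t at p ≡ just (var x))

Rule : Signature → Set
Rule 𝓕 = Term 𝓕 × Term 𝓕

TRS : Signature → Set₁
TRS 𝓕 = Rule 𝓕 → Set

module _ {𝓕 : Signature} where

  step : TRS 𝓕 → Term 𝓕 → Term 𝓕 → Set
  step S s t = ∃[ p ] ∃[ l ] ∃[ r ] ∃[ σ ]
    (S (l , r) × (s at p ≡ just (l ⟨ σ ⟩)) × (t ≡ s [ p ≔ r ⟨ σ ⟩ ]))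

  NormalForm : TRS 𝓕 → Term 𝓕 → Set
  NormalForm S t = ¬ (∃[ u ] step S t u)

  -- EV-safe reduction: B_i computed from B_{i-1}, the step position p_i and rule l_i → r_i
  nextB : Term 𝓕 → Term 𝓕 → Pos → PosSet → PosSet
  nextB l r p B q =
      (B q × ¬ (p ≼ q))
    ⊎ (∃[ q′ ] (q ≡ p ++ q′ × PosF r q′))
    ⊎ (∃[ p₁ ] ∃[ p′ ] ∃[ q′ ] ∃[ x ]
        (q ≡ p ++ (p′ ++ q′) × B (p ++ (p₁ ++ q′))
         × l at p₁ ≡ just (var x) × r at p′ ≡ just (var x)))

  data EVSafe (S : TRS 𝓕) : PosSet → Term 𝓕 → Term 𝓕 → Set₁ where
    done : ∀ {B t} → EVSafe S B t t
    next : ∀ {B s u} (p : Pos) (l r : Term 𝓕) (σ : Subst 𝓕) →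
           S (l , r) → s at p ≡ just (l ⟨ σ ⟩) → B p →
           EVSafe S (nextB l r p B) (s [ p ≔ r ⟨ σ ⟩ ]) u →
           EVSafe S B s u

  evs : TRS 𝓕 → Term 𝓕 → Term 𝓕 → Set₁
  evs S s t = EVSafe S (PosF s) s t

data Cond (𝓕 : Signature) : Set where
  _↠_ : Term 𝓕 → Term 𝓕 → Cond 𝓕
  _⇓_ : Term 𝓕 → Term 𝓕 → Cond 𝓕

record CRule (𝓕 : Signature) : Set where
  constructor mkCRule
  field
    lhs   : Term 𝓕
    rhs   : Term 𝓕
    conds : List (Cond 𝓕)
open CRule public

CTRS : Signature → Set₁
CTRS 𝓕 = CRule 𝓕 → Set

module _ {𝓕 : Signature} where

  condL condR : Cond 𝓕 → Term 𝓕
  condL (s ↠ t) = s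
  condL (s ⇓ t) = s
  condR (s ↠ t) = t
  condR (s ⇓ t) = t

  holds : (Term 𝓕 → Term 𝓕 → Set) → Subst 𝓕 → Cond 𝓕 → Set
  holds _⟶_ σ (s ↠ t) = Star _⟶_ (s ⟨ σ ⟩) (t ⟨ σ ⟩)
  holds _⟶_ σ (s ⇓ t) = ∃[ u ] (Star _⟶_ (s ⟨ σ ⟩) u × Star _⟶_ (t ⟨ σ ⟩) u)

  cstepN : CTRS 𝓕 → ℕ → Term 𝓕 → Term 𝓕 → Set
  cstepN R zero s t = ⊥
  cstepN R (suc n) s t = ∃[ p ] ∃[ ρ ] ∃[ σ ]
    (R ρ × (s at p ≡ just (lhs ρ ⟨ σ ⟩)) × (t ≡ s [ p ≔ rhs ρ ⟨ σ ⟩ ])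
     × All (holds (cstepN R n) σ) (conds ρ))

  cstep : CTRS 𝓕 → Term 𝓕 → Term 𝓕 → Set
  cstep R s t = ∃[ n ] cstepN R n s t

  underlying : CTRS 𝓕 → TRS 𝓕
  underlying R (l , r) = ∃[ ρ ] (R ρ × lhs ρ ≡ l × rhs ρ ≡ r)

  NonVar : Term 𝓕 → Set
  NonVar t = ∀ x → t ≢ var x

  NormalCTRS : CTRS 𝓕 → Set
  NormalCTRS R = ∀ ρ → R ρ →
    NonVar (lhs ρ) ×
    All (λ c → ∃[ s ] ∃[ n ] (c ≡ s ↠ n
                 × (∀ x → x ∈ varsOf s → x ∈ varsOf (lhs ρ))
                 × varsOf n ≡ []
                 × NormalForm (underlying R) n))
        (conds ρ)

  toJoin : Cond 𝓕 → Cond 𝓕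
  toJoin (s ↠ t) = s ⇓ t
  toJoin (s ⇓ t) = s ⇓ t

  joinRule : CRule 𝓕 → CRule 𝓕
  joinRule ρ = mkCRule (lhs ρ) (rhs ρ) (L.map toJoin (conds ρ))

  joinCTRS : CTRS 𝓕 → CTRS 𝓕
  joinCTRS R ρ′ = ∃[ ρ ] (R ρ × ρ′ ≡ joinRule ρ)

-- Extended signatures: F plus a fresh symbol U^ρ for every conditional rule ρ

ExtSig : (𝓕 : Signature) → (CRule 𝓕 → ℕ) → Signature
ExtSig 𝓕 a = sig (Sym 𝓕 ⊎ CRule 𝓕) [ ar 𝓕 , a ]

module _ {𝓕 : Signature} {a : CRule 𝓕 → ℕ} where

  mutual
    emb : Term 𝓕 → Term (ExtSig 𝓕 a)
    emb (var x) = var x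
    emb (fun f ts) = fun (inj₁ f) (embs ts)

    embs : ∀ {n} → Vec (Term 𝓕) n → Vec (Term (ExtSig 𝓕 a)) n
    embs [] = []
    embs (t ∷ ts) = emb t ∷ embs ts

  varVec : (l : Term 𝓕) → Vec (Term (ExtSig 𝓕 a)) (length (varList l))
  varVec l = mapᵥ var (fromList (varList l))

arityN : {𝓕 : Signature} → CRule 𝓕 → ℕ
arityN ρ = length (conds ρ) + length (varList (lhs ρ))

UNSig : Signature → Signature
UNSig 𝓕 = ExtSig 𝓕 arityN

data UN {𝓕 : Signature} (R : CTRS 𝓕) : TRS (UNSig 𝓕) where
  keep  : ∀ {ρ} → R ρ → conds ρ ≡ [] → UN R (emb (lhs ρ) , emb (rhs ρ))
  intro : ∀ {ρ} → R ρ → conds ρ ≢ [] →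
          UN R (emb (lhs ρ) ,
                fun (inj₂ ρ) (mapᵥ (emb ∘ condL) (fromList (conds ρ)) ++ᵥ varVec (lhs ρ)))
  elim  : ∀ {ρ} → R ρ → conds ρ ≢ [] →
          UN R (fun (inj₂ ρ) (mapᵥ (emb ∘ condR) (fromList (conds ρ)) ++ᵥ varVec (lhs ρ)) ,
                emb (rhs ρ))

jlen : {A : Set} → List A → ℕ
jlen [] = 0
jlen (c ∷ cs) = suc (suc (jlen cs))

arityJ : {𝓕 : Signature} → CRule 𝓕 → ℕ
arityJ ρ = jlen (conds ρ) + length (varList (lhs ρ))

UJSig : Signature → Signature
UJSig 𝓕 = ExtSig 𝓕 arityJ

module _ {𝓕 : Signature} where

  pairArgs : (cs : List (Cond 𝓕)) → Vec (Term (UJSig 𝓕)) (jlen cs)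
  pairArgs [] = []
  pairArgs (c ∷ cs) = emb (condL c) ∷ emb (condR c) ∷ pairArgs cs

  dupVars : ℕ → (cs : List (Cond 𝓕)) → Vec (Term (UJSig 𝓕)) (jlen cs)
  dupVars m [] = []
  dupVars m (c ∷ cs) = var m ∷ var m ∷ dupVars (suc m) cs

  maxList : List ℕ → ℕ
  maxList = foldr _⊔_ 0

  -- a bound strictly above every variable occurring in ρ
  freshBase : CRule 𝓕 → ℕ
  freshBase ρ = suc (maxList (varsOf (lhs ρ) ++ varsOf (rhs ρ)
                 ++ L.concat (L.map (λ c → varsOf (condL c) ++ varsOf (condR c)) (conds ρ))))

data UJ {𝓕 : Signature} (R : CTRS 𝓕) : TRS (UJSig 𝓕) where
  keep  : ∀ {ρ} → R ρ → conds ρ ≡ [] → UJ R (emb (lhs ρ) , emb (rhs ρ))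
  intro : ∀ {ρ} → R ρ → conds ρ ≢ [] →
          UJ R (emb (lhs ρ) , fun (inj₂ ρ) (pairArgs (conds ρ) ++ᵥ varVec (lhs ρ)))
  elim  : ∀ {ρ} → R ρ → conds ρ ≢ [] →
          UJ R (fun (inj₂ ρ) (dupVars (freshBase ρ) (conds ρ) ++ᵥ varVec (lhs ρ)) ,
                emb (rhs ρ))

Sound : {𝓕 : Signature} (a : CRule 𝓕 → ℕ) → (CTRS 𝓕 → TRS (ExtSig 𝓕 a)) → CTRS 𝓕 → Set
Sound {𝓕} a U R = ∀ (s t : Term 𝓕) →
  Star (step (U R)) (emb s) (emb t) → Star (cstep R) s t

SoundEVS : {𝓕 : Signature} (a : CRule 𝓕 → ℕ) → (CTRS 𝓕 → TRS (ExtSig 𝓕 a)) → CTRS 𝓕 → Set₁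
SoundEVS {𝓕} a U R = ∀ (s t : Term 𝓕) →
  evs (U R) (emb s) (emb t) → Star (cstep R) s t

module Submission where

-- A U_N(R)-term is translated into a U_J(R')-term by the map tr,
-- which is the identity on F-symbols and sends U^ρ(t₁,…,t_k,x⃗) to
-- U^ρ'(tr t₁,n₁,…,tr t_k,n_k,x⃗), inserting the ground right-hand side n_i
-- of each condition; positions are translated alongside (trPos).
--   1. tr commutes with subterm selection and replacement at translated
--      positions, and trPos is compatible with prefixes and substitution.
--   2. Every instance of a U_N(R) rule is mapped to an instance of the
--      corresponding U_J(R') rule (ruleSim).  Hence each U_N(R) step becomes a
--      U_J(R') step, and the EV-safe position sets of a U_N(R) sequence are
--      mapped into those of its translation, so EV-safety is preserved.
--   3. As every n_i is a ground R_u-normal form, s ↓ n_i in R' forces s →* n_i,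
--      so every R' step is an R step.
-- Since tr is the identity on F-terms, a U_N(R) derivation between F-terms is
-- a U_J(R') derivation between the same terms, hence by the hypothesis an R'
-- derivation, hence an R derivation.

open import Defs
open import Data.Product using (_×_; _,_; ∃-syntax; proj₂)
open import Data.Nat using (ℕ; zero; suc; _+_; _∸_; _<_; _≤_; _<?_; s≤s)
open import Data.Nat.Properties using (suc-injective; m+n∸m≡n; +-identityʳ; +-suc; m≤m⊔n; m≤n⊔m; ≤-trans; m+n≮m)
import Data.Nat.Properties as ℕ
open import Data.List using (List; []; _∷_; _++_; length)
import Data.List as L
open import Data.List.Properties using (++-conicalˡ; ++-conicalʳ)
open import Data.List.Membership.Propositional using (_∈_)
open import Data.List.Membership.Propositional.Properties using (∈-++⁺ˡ; ∈-++⁺ʳ; ∈-deduplicate⁻)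
open import Data.List.Relation.Unary.Any using (here; there)
open import Data.List.Relation.Unary.All using (All; []; _∷_)
import Data.List.Relation.Unary.All as All
open import Data.List.Relation.Unary.All.Properties using (map⁻)
open import Data.Vec using (Vec; []; _∷_; fromList) renaming (_++_ to _++ᵥ_; map to mapᵥ)
open import Data.Maybe using (Maybe; just; nothing; maybe′; _>>=_) renaming (map to mapMaybe)
open import Data.Sum using (inj₁; inj₂)
open import Data.Empty using (⊥-elim)
open import Function using (_∘_)
open import Relation.Nullary using (¬_; yes; no)
open import Relation.Binary.PropositionalEquality using (_≡_; _≢_; refl; sym; trans; cong; cong₂; subst; subst₂; module ≡-Reasoning)
open import Relation.Binary.Construct.Closure.ReflexiveTransitive using (Star; ε; _◅_)
import Relation.Binary.Construct.Closure.ReflexiveTransitive as Star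

-- Partial lookup and update at index i (out of range: nothing / no change).
-- The argument operations atArgs and replArgs of Defs factor through them.
lookupℕ : ∀ {A : Set} {n} → Vec A n → ℕ → Maybe A
lookupℕ [] i = nothing
lookupℕ (x ∷ xs) zero = just x
lookupℕ (x ∷ xs) (suc i) = lookupℕ xs i

updateℕ : ∀ {A : Set} {n} → Vec A n → ℕ → (A → A) → Vec A n
updateℕ [] i g = []
updateℕ (x ∷ xs) zero g = g x ∷ xs
updateℕ (x ∷ xs) (suc i) g = x ∷ updateℕ xs i g

lookup-update-same : ∀ {A : Set} {n} (xs : Vec A n) i g →
  lookupℕ (updateℕ xs i g) i ≡ mapMaybe g (lookupℕ xs i)
lookup-update-same [] i g = refl
lookup-update-same (x ∷ xs) zero g = refl
lookup-update-same (x ∷ xs) (suc i) g = lookup-update-same xs i g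

lookup-update-other : ∀ {A : Set} {n} (xs : Vec A n) i j g → i ≢ j →
  lookupℕ (updateℕ xs i g) j ≡ lookupℕ xs j
lookup-update-other [] i j g i≢j = refl
lookup-update-other (x ∷ xs) zero zero g i≢j = ⊥-elim (i≢j refl)
lookup-update-other (x ∷ xs) zero (suc j) g i≢j = refl
lookup-update-other (x ∷ xs) (suc i) zero g i≢j = refl
lookup-update-other (x ∷ xs) (suc i) (suc j) g i≢j =
  lookup-update-other xs i j g (i≢j ∘ cong suc)

-- Every element of a list is bounded by its maximum; this makes freshBase fresh.
≤-maxList : ∀ {𝓕 : Signature} {x} xs → x ∈ xs → x ≤ maxList {𝓕 = 𝓕} xs
≤-maxList {𝓕} (y ∷ ys) (here refl) = m≤m⊔n y (maxList {𝓕 = 𝓕} ys)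
≤-maxList {𝓕} (y ∷ ys) (there x∈ys) = ≤-trans (≤-maxList {𝓕} ys x∈ys) (m≤n⊔m y (maxList {𝓕 = 𝓕} ys))

module _ {S : Signature} where

  atArgs-lookup : ∀ {n} (ts : Vec (Term S) n) i p → atArgs ts i p ≡ (lookupℕ ts i >>= _at p)
  atArgs-lookup [] i p = refl
  atArgs-lookup (t ∷ ts) zero p = refl
  atArgs-lookup (t ∷ ts) (suc i) p = atArgs-lookup ts i p

  replArgs-update : ∀ {n} (ts : Vec (Term S) n) i p u → replArgs ts i p u ≡ updateℕ ts i (_[ p ≔ u ])
  replArgs-update [] i p u = refl
  replArgs-update (t ∷ ts) zero p u = refl
  replArgs-update (t ∷ ts) (suc i) p u = cong (t ∷_) (replArgs-update ts i p u)

  lookup-substs : ∀ {n} (ts : Vec (Term S) n) i σ → lookupℕ (substs ts σ) i ≡ mapMaybe (_⟨ σ ⟩) (lookupℕ ts i)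
  lookup-substs [] i σ = refl
  lookup-substs (t ∷ ts) zero σ = refl
  lookup-substs (t ∷ ts) (suc i) σ = lookup-substs ts i σ

  substs-++ : ∀ {m n} (ts : Vec (Term S) m) (us : Vec (Term S) n) σ →
    substs (ts ++ᵥ us) σ ≡ substs ts σ ++ᵥ substs us σ
  substs-++ [] us σ = refl
  substs-++ (t ∷ ts) us σ = cong (_ ∷_) (substs-++ ts us σ)

  AllArgs : (Term S → Set) → ∀ {n} → Vec (Term S) n → Set
  AllArgs P ts = ∀ i t → lookupℕ ts i ≡ just t → P t

  -- Structural induction on terms where the hypothesis for fun f ts covers
  -- every argument reachable by lookupℕ; it spares each lemma below a
  -- mutual induction over terms and argument vectors.
  module _ (P : Term S → Set) (P-var : ∀ x → P (var x))
           (P-fun : ∀ f ts → AllArgs P ts → P (fun f ts)) where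
    mutual
      term-ind : ∀ t → P t
      term-ind (var x) = P-var x
      term-ind (fun f ts) = P-fun f ts (args-ind ts)

      args-ind : ∀ {n} (ts : Vec (Term S) n) → AllArgs P ts
      args-ind [] i t ()
      args-ind (u ∷ ts) zero t refl = term-ind u
      args-ind (u ∷ ts) (suc i) t eq = args-ind ts i t eq

  at-subst : ∀ t p v σ → t at p ≡ just v → (t ⟨ σ ⟩) at p ≡ just (v ⟨ σ ⟩)
  at-subst = term-ind Claim
    (λ { x [] v σ refl → refl ; x (i ∷ p) v σ () })
    λ { f ts ih [] v σ refl → refl ; f ts ih (i ∷ p) v σ eq → inArgs ts ih i p v σ eq }
    where
    Claim : Term S → Set
    Claim t = ∀ p v σ → t at p ≡ just v → (t ⟨ σ ⟩) at p ≡ just (v ⟨ σ ⟩)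
    inArgs : ∀ {n} (ts : Vec (Term S) n) → AllArgs Claim ts →
             ∀ i p v σ → atArgs ts i p ≡ just v → atArgs (substs ts σ) i p ≡ just (v ⟨ σ ⟩)
    inArgs ts ih i p v σ eq
      rewrite atArgs-lookup (substs ts σ) i p | lookup-substs ts i σ | atArgs-lookup ts i p
      with lookupℕ ts i in tᵢ
    ... | just t = ih i t tᵢ p v σ eq

  at-replace : ∀ t p v u → t at p ≡ just v → (t [ p ≔ u ]) at p ≡ just u
  at-replace = term-ind Claim
    (λ { x [] v u refl → refl ; x (i ∷ p) v u () })
    λ { f ts ih [] v u refl → refl ; f ts ih (i ∷ p) v u eq → inArgs ts ih i p v u eq }
    where
    Claim : Term S → Set
    Claim t = ∀ p v u → t at p ≡ just v → (t [ p ≔ u ]) at p ≡ just u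
    inArgs : ∀ {n} (ts : Vec (Term S) n) → AllArgs Claim ts →
             ∀ i p v u → atArgs ts i p ≡ just v → atArgs (replArgs ts i p u) i p ≡ just u
    inArgs ts ih i p v u eq
      rewrite replArgs-update ts i p u | atArgs-lookup (updateℕ ts i (_[ p ≔ u ])) i p
            | lookup-update-same ts i (_[ p ≔ u ]) | atArgs-lookup ts i p
      with lookupℕ ts i in tᵢ
    ... | just t = ih i t tᵢ p v u eq

  mutual
    subst-ground : ∀ t σ → varsOf t ≡ [] → t ⟨ σ ⟩ ≡ t
    subst-ground (var x) σ ()
    subst-ground (fun f ts) σ noVars = cong (fun f) (substs-ground ts σ noVars)

    substs-ground : ∀ {n} (ts : Vec (Term S) n) σ → varsArgs ts ≡ [] → substs ts σ ≡ ts
    substs-ground [] σ noVars = refl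
    substs-ground (t ∷ ts) σ noVars =
      cong₂ _∷_ (subst-ground t σ (++-conicalˡ _ _ noVars))
                (substs-ground ts σ (++-conicalʳ (varsOf t) _ noVars))

  var-at⇒∈ : ∀ t p x → t at p ≡ just (var x) → x ∈ varsOf t
  var-at⇒∈ = term-ind Claim
    (λ { y [] x refl → here refl ; y (i ∷ p) x () })
    λ { f ts ih [] x () ; f ts ih (i ∷ p) x eq → inArgs ts ih i p x eq }
    where
    Claim : Term S → Set
    Claim t = ∀ p x → t at p ≡ just (var x) → x ∈ varsOf t
    inArgs : ∀ {n} (ts : Vec (Term S) n) → AllArgs Claim ts →
             ∀ i p x → atArgs ts i p ≡ just (var x) → x ∈ varsArgs ts
    inArgs [] ih i p x ()
    inArgs (t ∷ ts) ih zero p x eq = ∈-++⁺ˡ (ih zero t refl p x eq)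
    inArgs (t ∷ ts) ih (suc i) p x eq = ∈-++⁺ʳ (varsOf t) (inArgs ts (ih ∘ suc) i p x eq)

  varsVec : (xs : List ℕ) → Vec (Term S) (length xs)
  varsVec xs = mapᵥ var (fromList xs)

  -- The substitution that is σ below m and f (x ∸ m) from m on.  It instantiates
  -- the fresh variables of a U_J elimination rule without touching the others.
  splice : ℕ → Subst S → (ℕ → Term S) → Subst S
  splice m σ f x with x <? m
  ... | yes _ = σ x
  ... | no _ = f (x ∸ m)

  splice-below : ∀ m σ f x → x < m → splice m σ f x ≡ σ x
  splice-below m σ f x x<m with x <? m
  ... | yes _ = refl
  ... | no x≮m = ⊥-elim (x≮m x<m)

  splice-above : ∀ m σ f i → splice m σ f (m + i) ≡ f i
  splice-above m σ f i with (m + i) <? m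
  ... | yes m+i<m = ⊥-elim (m+n≮m m i m+i<m)
  ... | no _ = cong f (m+n∸m≡n m i)

module _ {𝓕 : Signature} {a : CRule 𝓕 → ℕ} where

  mutual
    vars-emb : (t : Term 𝓕) → varsOf (emb {a = a} t) ≡ varsOf t
    vars-emb (var x) = refl
    vars-emb (fun f ts) = vars-embs ts

    vars-embs : ∀ {n} (ts : Vec (Term 𝓕) n) → varsArgs (embs {a = a} ts) ≡ varsArgs ts
    vars-embs [] = refl
    vars-embs (t ∷ ts) = cong₂ _++_ (vars-emb t) (vars-embs ts)

  mutual
    emb-subst-agree : (t : Term 𝓕) (σ τ : Subst (ExtSig 𝓕 a)) →
      (∀ x → x ∈ varsOf t → σ x ≡ τ x) → emb t ⟨ σ ⟩ ≡ emb t ⟨ τ ⟩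
    emb-subst-agree (var x) σ τ agree = agree x (here refl)
    emb-subst-agree (fun f ts) σ τ agree = cong (fun (inj₁ f)) (embs-subst-agree ts σ τ agree)

    embs-subst-agree : ∀ {n} (ts : Vec (Term 𝓕) n) (σ τ : Subst (ExtSig 𝓕 a)) →
      (∀ x → x ∈ varsArgs ts → σ x ≡ τ x) → substs (embs ts) σ ≡ substs (embs ts) τ
    embs-subst-agree [] σ τ agree = refl
    embs-subst-agree (t ∷ ts) σ τ agree =
      cong₂ _∷_ (emb-subst-agree t σ τ (λ x x∈ → agree x (∈-++⁺ˡ x∈)))
                (embs-subst-agree ts σ τ (λ x x∈ → agree x (∈-++⁺ʳ (varsOf t) x∈)))

  emb-ground : (t : Term 𝓕) (σ : Subst (ExtSig 𝓕 a)) → varsOf t ≡ [] → emb t ⟨ σ ⟩ ≡ emb t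
  emb-ground t σ noVars = subst-ground (emb t) σ (trans (vars-emb t) noVars)

-- The translation from U_N(R)-terms to U_J(R')-terms

module Translation {𝓕 : Signature} where

  TermN TermJ : Set
  TermN = Term (UNSig 𝓕)
  TermJ = Term (UJSig 𝓕)

  trSym : Sym (UNSig 𝓕) → Sym (UJSig 𝓕)
  trSym (inj₁ f) = inj₁ f
  trSym (inj₂ ρ) = inj₂ (joinRule ρ)

  -- Where the i-th argument of U^ρ goes in U^ρ': the k condition arguments
  -- are spread to the even slots 0,2,…,2k−2, the variables are shifted by k.
  spreadIndex : ∀ {A : Set} → List A → ℕ → ℕ
  spreadIndex [] i = i
  spreadIndex (c ∷ cs) zero = zero
  spreadIndex (c ∷ cs) (suc i) = suc (suc (spreadIndex cs i))

  trIndex : Sym (UNSig 𝓕) → ℕ → ℕ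
  trIndex (inj₁ f) i = i
  trIndex (inj₂ ρ) i = spreadIndex (conds ρ) i

  mutual
    tr : TermN → TermJ
    tr (var x) = var x
    tr (fun f ts) = fun (trSym f) (trFunArgs f ts)

    trFunArgs : (f : Sym (UNSig 𝓕)) → Vec TermN (ar (UNSig 𝓕) f) → Vec TermJ (ar (UJSig 𝓕) (trSym f))
    trFunArgs (inj₁ f) ts = trs ts
    trFunArgs (inj₂ ρ) ts = interleave (conds ρ) ts

    trs : ∀ {n} → Vec TermN n → Vec TermJ n
    trs [] = []
    trs (t ∷ ts) = tr t ∷ trs ts

    interleave : ∀ {m} (cs : List (Cond 𝓕)) → Vec TermN (length cs + m) → Vec TermJ (jlen (L.map toJoin cs) + m)
    interleave [] ts = trs ts
    interleave (c ∷ cs) (t ∷ ts) = tr t ∷ emb (condR c) ∷ interleave cs ts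

  mutual
    trPos : TermN → Pos → Pos
    trPos t [] = []
    trPos (var x) (i ∷ p) = i ∷ p
    trPos (fun f ts) (i ∷ p) = trIndex f i ∷ trPosArgs ts i p

    trPosArgs : ∀ {n} → Vec TermN n → ℕ → Pos → Pos
    trPosArgs [] i p = p
    trPosArgs (t ∷ ts) zero p = trPos t p
    trPosArgs (t ∷ ts) (suc i) p = trPosArgs ts i p

  trPosArgs-lookup : ∀ {n} (ts : Vec TermN n) i p → trPosArgs ts i p ≡ maybe′ (λ t → trPos t p) p (lookupℕ ts i)
  trPosArgs-lookup [] i p = refl
  trPosArgs-lookup (t ∷ ts) zero p = refl
  trPosArgs-lookup (t ∷ ts) (suc i) p = trPosArgs-lookup ts i p

  lookup-trs : ∀ {n} (ts : Vec TermN n) i → lookupℕ (trs ts) i ≡ mapMaybe tr (lookupℕ ts i)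
  lookup-trs [] i = refl
  lookup-trs (t ∷ ts) zero = refl
  lookup-trs (t ∷ ts) (suc i) = lookup-trs ts i

  lookup-interleave : ∀ {m} cs (ts : Vec TermN (length cs + m)) i →
    lookupℕ (interleave cs ts) (spreadIndex cs i) ≡ mapMaybe tr (lookupℕ ts i)
  lookup-interleave [] ts i = lookup-trs ts i
  lookup-interleave (c ∷ cs) (t ∷ ts) zero = refl
  lookup-interleave (c ∷ cs) (t ∷ ts) (suc i) = lookup-interleave cs ts i

  lookup-trFunArgs : ∀ f ts i → lookupℕ (trFunArgs f ts) (trIndex f i) ≡ mapMaybe tr (lookupℕ ts i)
  lookup-trFunArgs (inj₁ f) ts i = lookup-trs ts i
  lookup-trFunArgs (inj₂ ρ) ts i = lookup-interleave (conds ρ) ts i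

  Simulates : (TermN → TermN) → (TermJ → TermJ) → Maybe TermN → Set
  Simulates g g' mt = ∀ t → mt ≡ just t → tr (g t) ≡ g' (tr t)

  update-trs : ∀ {n} (ts : Vec TermN n) i g g' → Simulates g g' (lookupℕ ts i) →
    trs (updateℕ ts i g) ≡ updateℕ (trs ts) i g'
  update-trs [] i g g' sim = refl
  update-trs (t ∷ ts) zero g g' sim = cong (_∷ _) (sim t refl)
  update-trs (t ∷ ts) (suc i) g g' sim = cong (_ ∷_) (update-trs ts i g g' sim)

  update-interleave : ∀ {m} cs (ts : Vec TermN (length cs + m)) i g g' → Simulates g g' (lookupℕ ts i) →
    interleave cs (updateℕ ts i g) ≡ updateℕ (interleave cs ts) (spreadIndex cs i) g'
  update-interleave [] ts i g g' sim = update-trs ts i g g' sim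
  update-interleave (c ∷ cs) (t ∷ ts) zero g g' sim = cong (_∷ _) (sim t refl)
  update-interleave (c ∷ cs) (t ∷ ts) (suc i) g g' sim = cong (λ z → _ ∷ _ ∷ z) (update-interleave cs ts i g g' sim)

  update-trFunArgs : ∀ f ts i g g' → Simulates g g' (lookupℕ ts i) →
    trFunArgs f (updateℕ ts i g) ≡ updateℕ (trFunArgs f ts) (trIndex f i) g'
  update-trFunArgs (inj₁ f) ts i g g' sim = update-trs ts i g g' sim
  update-trFunArgs (inj₂ ρ) ts i g g' sim = update-interleave (conds ρ) ts i g g' sim

  -- Distinct arguments stay distinct; this lets trPos reflect the prefix order.
  spreadIndex-injective : ∀ {A : Set} (cs : List A) i j → spreadIndex cs i ≡ spreadIndex cs j → i ≡ j
  spreadIndex-injective [] i j eq = eq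
  spreadIndex-injective (c ∷ cs) zero zero eq = refl
  spreadIndex-injective (c ∷ cs) zero (suc j) ()
  spreadIndex-injective (c ∷ cs) (suc i) zero ()
  spreadIndex-injective (c ∷ cs) (suc i) (suc j) eq =
    cong suc (spreadIndex-injective cs i j (suc-injective (suc-injective eq)))

  trIndex-injective : ∀ f i j → trIndex f i ≡ trIndex f j → i ≡ j
  trIndex-injective (inj₁ f) i j eq = eq
  trIndex-injective (inj₂ ρ) i j eq = spreadIndex-injective (conds ρ) i j eq

  tr-at : ∀ t p → tr t at trPos t p ≡ mapMaybe tr (t at p)
  tr-at = term-ind Claim
    (λ { x [] → refl ; x (i ∷ p) → refl })
    λ { f ts ih [] → refl ; f ts ih (i ∷ p) → inArgs f ts ih i p }
    where
    Claim : TermN → Set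
    Claim t = ∀ p → tr t at trPos t p ≡ mapMaybe tr (t at p)
    inArgs : ∀ f ts → AllArgs Claim ts →
             ∀ i p → atArgs (trFunArgs f ts) (trIndex f i) (trPosArgs ts i p) ≡ mapMaybe tr (atArgs ts i p)
    inArgs f ts ih i p
      rewrite atArgs-lookup (trFunArgs f ts) (trIndex f i) (trPosArgs ts i p) | lookup-trFunArgs f ts i
            | atArgs-lookup ts i p | trPosArgs-lookup ts i p
      with lookupℕ ts i in tᵢ
    ... | nothing = refl
    ... | just t = ih i t tᵢ p

  tr-replace : ∀ t p u → tr (t [ p ≔ u ]) ≡ tr t [ trPos t p ≔ tr u ]
  tr-replace = term-ind Claim
    (λ { x [] u → refl ; x (i ∷ p) u → refl })
    λ { f ts ih [] u → refl ; f ts ih (i ∷ p) u → cong (fun (trSym f)) (inArgs f ts ih i p u) }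
    where
    Claim : TermN → Set
    Claim t = ∀ p u → tr (t [ p ≔ u ]) ≡ tr t [ trPos t p ≔ tr u ]
    inArgs : ∀ f ts → AllArgs Claim ts →
             ∀ i p u → trFunArgs f (replArgs ts i p u)
                       ≡ replArgs (trFunArgs f ts) (trIndex f i) (trPosArgs ts i p) (tr u)
    inArgs f ts ih i p u
      rewrite replArgs-update ts i p u | replArgs-update (trFunArgs f ts) (trIndex f i) (trPosArgs ts i p) (tr u) =
      update-trFunArgs f ts i _ _ λ t tᵢ →
        trans (ih i t tᵢ p u)
              (cong (λ q → tr t [ q ≔ tr u ])
                    (sym (trans (trPosArgs-lookup ts i p) (cong (maybe′ (λ t → trPos t p) p) tᵢ))))

  trPos-replace-outside : ∀ s p q u → ¬ (p ≼ q) → trPos (s [ p ≔ u ]) q ≡ trPos s q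
  trPos-replace-outside = term-ind Claim
    (λ { x [] q u p⋠q → ⊥-elim (p⋠q (q , refl)) ; x (i ∷ p) [] u p⋠q → refl ; x (i ∷ p) (j ∷ q) u p⋠q → refl })
    λ { f ts ih [] q u p⋠q → ⊥-elim (p⋠q (q , refl)) ; f ts ih (i ∷ p) [] u p⋠q → refl
      ; f ts ih (i ∷ p) (j ∷ q) u p⋠q → cong (trIndex f j ∷_) (inArgs ts ih i p j q u p⋠q) }
    where
    Claim : TermN → Set
    Claim s = ∀ p q u → ¬ (p ≼ q) → trPos (s [ p ≔ u ]) q ≡ trPos s q
    inArgs : ∀ {n} (ts : Vec TermN n) → AllArgs Claim ts →
             ∀ i p j q u → ¬ ((i ∷ p) ≼ (j ∷ q)) → trPosArgs (replArgs ts i p u) j q ≡ trPosArgs ts j q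
    inArgs ts ih i p j q u p⋠q
      rewrite replArgs-update ts i p u | trPosArgs-lookup (updateℕ ts i (_[ p ≔ u ])) j q | trPosArgs-lookup ts j q
      with i ℕ.≟ j
    ... | no i≢j rewrite lookup-update-other ts i j (_[ p ≔ u ]) i≢j = refl
    ... | yes refl rewrite lookup-update-same ts i (_[ p ≔ u ]) with lookupℕ ts i in tᵢ
    ...   | nothing = refl
    ...   | just t = ih i t tᵢ p q u λ { (r , eq) → p⋠q (r , cong (i ∷_) eq) }

  trPos-replace-at : ∀ s p u → trPos (s [ p ≔ u ]) p ≡ trPos s p
  trPos-replace-at = term-ind Claim
    (λ { x [] u → refl ; x (i ∷ p) u → refl })
    λ { f ts ih [] u → refl ; f ts ih (i ∷ p) u → cong (trIndex f i ∷_) (inArgs ts ih i p u) }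
    where
    Claim : TermN → Set
    Claim s = ∀ p u → trPos (s [ p ≔ u ]) p ≡ trPos s p
    inArgs : ∀ {n} (ts : Vec TermN n) → AllArgs Claim ts →
             ∀ i p u → trPosArgs (replArgs ts i p u) i p ≡ trPosArgs ts i p
    inArgs ts ih i p u
      rewrite replArgs-update ts i p u | trPosArgs-lookup (updateℕ ts i (_[ p ≔ u ])) i p | trPosArgs-lookup ts i p
            | lookup-update-same ts i (_[ p ≔ u ])
      with lookupℕ ts i in tᵢ
    ... | nothing = refl
    ... | just t = ih i t tᵢ p u

  trPos-reflects-≼ : ∀ s p q → trPos s p ≼ trPos s q → p ≼ q
  trPos-reflects-≼ = term-ind Claim
    (λ { x [] q _ → q , refl ; x (i ∷ p) [] (r , ()) ; x (i ∷ p) (j ∷ q) p≼q → p≼q })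
    λ { f ts ih [] q _ → q , refl ; f ts ih (i ∷ p) [] (r , ())
      ; f ts ih (i ∷ p) (j ∷ q) (r , eq) → inArgs f ts ih i p j q r eq }
    where
    Claim : TermN → Set
    Claim s = ∀ p q → trPos s p ≼ trPos s q → p ≼ q
    head′ : Pos → ℕ
    head′ [] = 0
    head′ (i ∷ _) = i
    tail′ : Pos → Pos
    tail′ [] = []
    tail′ (_ ∷ p) = p
    inArgs : ∀ f ts → AllArgs Claim ts →
             ∀ i p j q r → (trIndex f j ∷ trPosArgs ts j q) ≡ (trIndex f i ∷ trPosArgs ts i p) ++ r → (i ∷ p) ≼ (j ∷ q)
    inArgs f ts ih i p j q r eq with trIndex-injective f j i (cong head′ eq)
    ... | refl rewrite trPosArgs-lookup ts i p | trPosArgs-lookup ts i q with lookupℕ ts i in tᵢ | cong tail′ eq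
    ...   | nothing | eq′ = r , cong (i ∷_) eq′
    ...   | just t | eq′ with ih i t tᵢ p q (r , eq′)
    ...     | (r′ , eq″) = r′ , cong (i ∷_) eq″

  trPos-++ : ∀ s p u q → s at p ≡ just u → trPos s (p ++ q) ≡ trPos s p ++ trPos u q
  trPos-++ = term-ind Claim
    (λ { x [] u q refl → refl ; x (i ∷ p) u q () })
    λ { f ts ih [] u q refl → refl ; f ts ih (i ∷ p) u q eq → cong (trIndex f i ∷_) (inArgs ts ih i p u q eq) }
    where
    Claim : TermN → Set
    Claim s = ∀ p u q → s at p ≡ just u → trPos s (p ++ q) ≡ trPos s p ++ trPos u q
    inArgs : ∀ {n} (ts : Vec TermN n) → AllArgs Claim ts →
             ∀ i p u q → atArgs ts i p ≡ just u → trPosArgs ts i (p ++ q) ≡ trPosArgs ts i p ++ trPos u q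
    inArgs ts ih i p u q eq
      rewrite trPosArgs-lookup ts i (p ++ q) | trPosArgs-lookup ts i p | atArgs-lookup ts i p
      with lookupℕ ts i in tᵢ
    ... | just t = ih i t tᵢ p u q eq

  trPos-subst : ∀ t q v σ → t at q ≡ just v → trPos (t ⟨ σ ⟩) q ≡ trPos t q
  trPos-subst = term-ind Claim
    (λ { x [] v σ _ → refl ; x (i ∷ q) v σ () })
    λ { f ts ih [] v σ _ → refl ; f ts ih (i ∷ q) v σ eq → cong (trIndex f i ∷_) (inArgs ts ih i q v σ eq) }
    where
    Claim : TermN → Set
    Claim t = ∀ q v σ → t at q ≡ just v → trPos (t ⟨ σ ⟩) q ≡ trPos t q
    inArgs : ∀ {n} (ts : Vec TermN n) → AllArgs Claim ts →
             ∀ i q v σ → atArgs ts i q ≡ just v → trPosArgs (substs ts σ) i q ≡ trPosArgs ts i q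
    inArgs ts ih i q v σ eq
      rewrite trPosArgs-lookup (substs ts σ) i q | lookup-substs ts i σ | trPosArgs-lookup ts i q | atArgs-lookup ts i q
      with lookupℕ ts i in tᵢ
    ... | just t = ih i t tᵢ q v σ eq

  trPos-through-var : ∀ s p t σ p′ x q′ → s at p ≡ just (t ⟨ σ ⟩) → t at p′ ≡ just (var x) →
    trPos s (p ++ (p′ ++ q′)) ≡ trPos s p ++ (trPos t p′ ++ trPos (σ x) q′)
  trPos-through-var s p t σ p′ x q′ s|p t|p′ =
    trans (trPos-++ s p (t ⟨ σ ⟩) (p′ ++ q′) s|p)
          (cong (trPos s p ++_)
                (trans (trPos-++ (t ⟨ σ ⟩) p′ (σ x) q′ (at-subst t p′ (var x) σ t|p′))
                       (cong (_++ trPos (σ x) q′) (trPos-subst t p′ (var x) σ t|p′))))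

  tr-PosF : ∀ t q → PosF t q → PosF (tr t) (trPos t q)
  tr-PosF t q (f , ts , t|q) rewrite tr-at t q | t|q = trSym f , trFunArgs f ts , refl

  mutual
    tr-emb : (t : Term 𝓕) → tr (emb t) ≡ emb t
    tr-emb (var x) = refl
    tr-emb (fun f ts) = cong (fun (inj₁ f)) (trs-embs ts)

    trs-embs : ∀ {n} (ts : Vec (Term 𝓕) n) → trs (embs ts) ≡ embs ts
    trs-embs [] = refl
    trs-embs (t ∷ ts) = cong₂ _∷_ (tr-emb t) (trs-embs ts)

  mutual
    tr-subst-emb : (t : Term 𝓕) (σ : Subst (UNSig 𝓕)) → tr (emb t ⟨ σ ⟩) ≡ emb t ⟨ tr ∘ σ ⟩
    tr-subst-emb (var x) σ = refl
    tr-subst-emb (fun f ts) σ = cong (fun (inj₁ f)) (trs-substs-embs ts σ)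

    trs-substs-embs : ∀ {n} (ts : Vec (Term 𝓕) n) (σ : Subst (UNSig 𝓕)) →
      trs (substs (embs ts) σ) ≡ substs (embs ts) (tr ∘ σ)
    trs-substs-embs [] σ = refl
    trs-substs-embs (t ∷ ts) σ = cong₂ _∷_ (tr-subst-emb t σ) (trs-substs-embs ts σ)

  interleaveConds : (cs : List (Cond 𝓕)) → Vec TermN (length cs) → Vec TermJ (jlen (L.map toJoin cs))
  interleaveConds [] [] = []
  interleaveConds (c ∷ cs) (t ∷ ts) = tr t ∷ emb (condR c) ∷ interleaveConds cs ts

  interleave-++ : ∀ {m} cs (ts : Vec TermN (length cs)) (us : Vec TermN m) →
    interleave cs (ts ++ᵥ us) ≡ interleaveConds cs ts ++ᵥ trs us
  interleave-++ [] [] us = refl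
  interleave-++ (c ∷ cs) (t ∷ ts) us = cong (λ z → _ ∷ _ ∷ z) (interleave-++ cs ts us)

  trs-varsVec : ∀ (xs : List ℕ) (σ : Subst (UNSig 𝓕)) (σ′ : Subst (UJSig 𝓕)) →
    (∀ x → x ∈ xs → σ′ x ≡ tr (σ x)) → trs (substs (varsVec xs) σ) ≡ substs (varsVec xs) σ′
  trs-varsVec [] σ σ′ agree = refl
  trs-varsVec (x ∷ xs) σ σ′ agree =
    cong₂ _∷_ (sym (agree x (here refl))) (trs-varsVec xs σ σ′ (λ y y∈ → agree y (there y∈)))

  trs-varsVec-plain : ∀ (xs : List ℕ) → trs (varsVec xs) ≡ varsVec xs
  trs-varsVec-plain [] = refl
  trs-varsVec-plain (x ∷ xs) = cong (_ ∷_) (trs-varsVec-plain xs)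

  trPosArgs-varsVec : ∀ (xs : List ℕ) i p → trPosArgs (varsVec xs) i p ≡ p
  trPosArgs-varsVec [] i p = refl
  trPosArgs-varsVec (x ∷ xs) zero [] = refl
  trPosArgs-varsVec (x ∷ xs) zero (j ∷ p) = refl
  trPosArgs-varsVec (x ∷ xs) (suc i) p = trPosArgs-varsVec xs i p

  atArgs-varsVec : ∀ (xs : List ℕ) i p x → atArgs {𝓕 = UNSig 𝓕} (varsVec xs) i p ≡ just (var x) →
    atArgs {𝓕 = UJSig 𝓕} (varsVec xs) i p ≡ just (var x)
  atArgs-varsVec [] i p x ()
  atArgs-varsVec (y ∷ xs) zero [] x refl = refl
  atArgs-varsVec (y ∷ xs) zero (j ∷ p) x ()
  atArgs-varsVec (y ∷ xs) (suc i) p x eq = atArgs-varsVec xs i p x eq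

  GroundRhs : Cond 𝓕 → Set
  GroundRhs c = varsOf (condR c) ≡ []

  -- Introduction rule arguments: translating s⃗σ gives the U_J arguments
  -- s₁σ, n₁, …, s_kσ, n_k, because the n_i are ground.
  interleave-intro : ∀ cs (σ : Subst (UNSig 𝓕)) → All GroundRhs cs →
    interleaveConds cs (substs (mapᵥ (emb ∘ condL) (fromList cs)) σ) ≡ substs (pairArgs (L.map toJoin cs)) (tr ∘ σ)
  interleave-intro [] σ [] = refl
  interleave-intro ((s ↠ n) ∷ cs) σ (g ∷ gs) =
    cong₂ _∷_ (tr-subst-emb s σ) (cong₂ _∷_ (sym (emb-ground n (tr ∘ σ) g)) (interleave-intro cs σ gs))
  interleave-intro ((s ⇓ n) ∷ cs) σ (g ∷ gs) =
    cong₂ _∷_ (tr-subst-emb s σ) (cong₂ _∷_ (sym (emb-ground n (tr ∘ σ) g)) (interleave-intro cs σ gs))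

  interleave-intro-plain : ∀ cs → interleaveConds cs (mapᵥ (emb ∘ condL) (fromList cs)) ≡ pairArgs (L.map toJoin cs)
  interleave-intro-plain [] = refl
  interleave-intro-plain ((s ↠ n) ∷ cs) = cong₂ _∷_ (tr-emb s) (cong (_ ∷_) (interleave-intro-plain cs))
  interleave-intro-plain ((s ⇓ n) ∷ cs) = cong₂ _∷_ (tr-emb s) (cong (_ ∷_) (interleave-intro-plain cs))

  -- i-th condition right-hand side n_i (a dummy beyond the end)
  condRhs : List (Cond 𝓕) → ℕ → TermJ
  condRhs [] i = var 0
  condRhs (c ∷ cs) zero = emb (condR c)
  condRhs (c ∷ cs) (suc i) = condRhs cs i

  interleave-elim : ∀ cs b (σ : Subst (UNSig 𝓕)) (σ′ : Subst (UJSig 𝓕)) →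
    (∀ i → σ′ (b + i) ≡ condRhs cs i) → All GroundRhs cs →
    interleaveConds cs (substs (mapᵥ (emb ∘ condR) (fromList cs)) σ) ≡ substs (dupVars b (L.map toJoin cs)) σ′
  interleave-elim [] b σ σ′ σ′-fresh [] = refl
  interleave-elim (c ∷ cs) b σ σ′ σ′-fresh (g ∷ gs) =
    cong₂ _∷_ (trans trNσ (sym σ′b)) (cong₂ _∷_ (sym σ′b) (interleave-elim cs (suc b) σ σ′ σ′-fresh′ gs))
    where
    σ′b : σ′ b ≡ emb (condR c)
    σ′b = trans (cong σ′ (sym (+-identityʳ b))) (σ′-fresh 0)
    trNσ : tr (emb (condR c) ⟨ σ ⟩) ≡ emb (condR c)
    trNσ = trans (cong tr (emb-ground (condR c) σ g)) (tr-emb (condR c))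
    σ′-fresh′ : ∀ i → σ′ (suc b + i) ≡ condRhs cs i
    σ′-fresh′ i = trans (cong σ′ (sym (+-suc b i))) (σ′-fresh (suc i))

  -- A variable of the U_N elimination left-hand side U^ρ(n⃗, x⃗) lies in x⃗,
  -- so it is found at the translated position of U^ρ'(x₁,x₁,…, x⃗) as well.
  elim-var-at : ∀ cs (xs : List ℕ) b i p x → All GroundRhs cs →
    atArgs {𝓕 = UNSig 𝓕} (mapᵥ (emb ∘ condR) (fromList cs) ++ᵥ varsVec xs) i p ≡ just (var x) →
    atArgs (dupVars b (L.map toJoin cs) ++ᵥ varsVec xs) (spreadIndex cs i)
      (trPosArgs (mapᵥ (emb ∘ condR) (fromList cs) ++ᵥ varsVec xs) i p) ≡ just (var x)
  elim-var-at [] xs b i p x gs eq rewrite trPosArgs-varsVec xs i p = atArgs-varsVec xs i p x eq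
  elim-var-at (c ∷ cs) xs b zero p x (g ∷ gs) eq
    with subst (x ∈_) (trans (vars-emb (condR c)) g) (var-at⇒∈ (emb (condR c)) p x eq)
  ... | ()
  elim-var-at (c ∷ cs) xs b (suc i) p x (g ∷ gs) eq = elim-var-at cs xs (suc b) i p x gs eq

open Translation

NormalCond : ∀ {𝓕 : Signature} → CTRS 𝓕 → CRule 𝓕 → Cond 𝓕 → Set
NormalCond R ρ c = ∃[ s ] ∃[ n ] (c ≡ s ↠ n
                     × (∀ x → x ∈ varsOf s → x ∈ varsOf (lhs ρ))
                     × varsOf n ≡ []
                     × NormalForm (underlying R) n)

normalConds : ∀ {𝓕 : Signature} {R : CTRS 𝓕} → NormalCTRS R → ∀ {ρ} → R ρ → All (NormalCond R ρ) (conds ρ)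
normalConds normal Rρ = proj₂ (normal _ Rρ)

groundRhss : ∀ {𝓕 : Signature} {R : CTRS 𝓕} → NormalCTRS R → ∀ {ρ} → R ρ → All GroundRhs (conds ρ)
groundRhss normal Rρ = All.map (λ { (s , n , refl , _ , ground , _) → ground }) (normalConds normal Rρ)

-- Simulation of U_N(R) by U_J(R')

module Simulation {𝓕 : Signature} (R : CTRS 𝓕) (normal : NormalCTRS R) where

  open ≡-Reasoning

  R′ : CTRS 𝓕
  R′ = joinCTRS R

  record RuleSim (l r : TermN {𝓕}) (σ : Subst (UNSig 𝓕)) : Set where
    field
      lJ rJ : TermJ {𝓕}
      σJ : Subst (UJSig 𝓕)
      isRule : UJ R′ (lJ , rJ)
      lhs-inst : tr (l ⟨ σ ⟩) ≡ lJ ⟨ σJ ⟩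
      rhs-inst : tr (r ⟨ σ ⟩) ≡ rJ ⟨ σJ ⟩
      rhs-tr : rJ ≡ tr r
      lhs-vars : ∀ p x → l at p ≡ just (var x) → lJ at trPos l p ≡ just (var x)

  conds-join-≢[] : (cs : List (Cond 𝓕)) → cs ≢ [] → L.map toJoin cs ≢ []
  conds-join-≢[] [] cs≢[] _ = cs≢[] refl
  conds-join-≢[] (c ∷ cs) cs≢[] ()

  emb-lhs-vars : ∀ (l : Term 𝓕) p x → emb {a = arityN} l at p ≡ just (var x) →
    emb {a = arityJ} l at trPos (emb l) p ≡ just (var x)
  emb-lhs-vars l p x l|p with tr-at (emb l) p
  ... | trl|p rewrite tr-emb l | l|p = trl|p

  keepSim : ∀ {ρ} → R ρ → conds ρ ≡ [] → ∀ σ → RuleSim (emb (lhs ρ)) (emb (rhs ρ)) σ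
  keepSim {ρ} Rρ noConds σ = record
    { lJ = emb (lhs ρ) ; rJ = emb (rhs ρ) ; σJ = tr ∘ σ
    ; isRule = keep (ρ , Rρ , refl) (cong (L.map toJoin) noConds)
    ; lhs-inst = tr-subst-emb (lhs ρ) σ
    ; rhs-inst = tr-subst-emb (rhs ρ) σ
    ; rhs-tr = sym (tr-emb (rhs ρ))
    ; lhs-vars = emb-lhs-vars (lhs ρ) }

  introSim : ∀ {ρ} → R ρ → conds ρ ≢ [] → ∀ σ →
    RuleSim (emb (lhs ρ)) (fun (inj₂ ρ) (mapᵥ (emb ∘ condL) (fromList (conds ρ)) ++ᵥ varVec (lhs ρ))) σ
  introSim {ρ} Rρ hasConds σ = record
    { lJ = emb (lhs ρ) ; rJ = fun (inj₂ (joinRule ρ)) (pairArgs csJ ++ᵥ varsVec xs) ; σJ = tr ∘ σ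
    ; isRule = intro (ρ , Rρ , refl) (conds-join-≢[] cs hasConds)
    ; lhs-inst = tr-subst-emb (lhs ρ) σ
    ; rhs-inst = cong (fun (inj₂ (joinRule ρ))) args-inst
    ; rhs-tr = cong (fun (inj₂ (joinRule ρ))) (sym args-plain)
    ; lhs-vars = emb-lhs-vars (lhs ρ) }
    where
    cs csJ : List (Cond 𝓕)
    cs = conds ρ
    csJ = L.map toJoin cs
    xs : List ℕ
    xs = varList (lhs ρ)
    ss : Vec (TermN {𝓕}) (length cs)
    ss = mapᵥ (emb ∘ condL) (fromList cs)
    args-inst : interleave cs (substs (ss ++ᵥ varsVec xs) σ) ≡ substs (pairArgs csJ ++ᵥ varsVec xs) (tr ∘ σ)
    args-inst = begin
      interleave cs (substs (ss ++ᵥ varsVec xs) σ)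
        ≡⟨ cong (interleave cs) (substs-++ ss (varsVec xs) σ) ⟩
      interleave cs (substs ss σ ++ᵥ substs (varsVec xs) σ)
        ≡⟨ interleave-++ cs _ _ ⟩
      interleaveConds cs (substs ss σ) ++ᵥ trs (substs (varsVec xs) σ)
        ≡⟨ cong₂ _++ᵥ_ (interleave-intro cs σ (groundRhss normal Rρ)) (trs-varsVec xs σ (tr ∘ σ) (λ _ _ → refl)) ⟩
      substs (pairArgs csJ) (tr ∘ σ) ++ᵥ substs (varsVec xs) (tr ∘ σ)
        ≡⟨ sym (substs-++ (pairArgs csJ) (varsVec xs) (tr ∘ σ)) ⟩
      substs (pairArgs csJ ++ᵥ varsVec xs) (tr ∘ σ) ∎
    args-plain : interleave cs (ss ++ᵥ varsVec xs) ≡ pairArgs csJ ++ᵥ varsVec xs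
    args-plain = trans (interleave-++ cs ss (varsVec xs))
                       (cong₂ _++ᵥ_ (interleave-intro-plain cs) (trs-varsVec-plain xs))

  -- U^ρ(n⃗, x⃗) → r is simulated by U^ρ'(x₁, x₁, …, x_k, x_k, x⃗) → r, where σJ
  -- is tr ∘ σ on the old variables and sends each fresh x_i to n_i.
  elimSim : ∀ {ρ} → R ρ → conds ρ ≢ [] → ∀ σ →
    RuleSim (fun (inj₂ ρ) (mapᵥ (emb ∘ condR) (fromList (conds ρ)) ++ᵥ varVec (lhs ρ))) (emb (rhs ρ)) σ
  elimSim {ρ} Rρ hasConds σ = record
    { lJ = fun (inj₂ ρ′) (dupVars m csJ ++ᵥ varsVec xs) ; rJ = emb (rhs ρ) ; σJ = σJ
    ; isRule = elim (ρ , Rρ , refl) (conds-join-≢[] cs hasConds)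
    ; lhs-inst = cong (fun (inj₂ ρ′)) args-inst
    ; rhs-inst = trans (tr-subst-emb (rhs ρ) σ)
                       (emb-subst-agree (rhs ρ) (tr ∘ σ) σJ
                         (λ x x∈ → sym (splice-below m (tr ∘ σ) (condRhs cs) x (rhs-below x x∈))))
    ; rhs-tr = sym (tr-emb (rhs ρ))
    ; lhs-vars = λ { [] x () ; (i ∷ p) x l|p → elim-var-at cs xs m i p x (groundRhss normal Rρ) l|p } }
    where
    ρ′ : CRule 𝓕
    ρ′ = joinRule ρ
    cs csJ : List (Cond 𝓕)
    cs = conds ρ
    csJ = L.map toJoin cs
    xs : List ℕ
    xs = varList (lhs ρ)
    ns : Vec (TermN {𝓕}) (length cs)
    ns = mapᵥ (emb ∘ condR) (fromList cs)
    m : ℕ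
    m = freshBase ρ′
    σJ : Subst (UJSig 𝓕)
    σJ = splice m (tr ∘ σ) (condRhs cs)
    rhs-below : ∀ x → x ∈ varsOf (rhs ρ) → x < m
    rhs-below x x∈ = s≤s (≤-maxList {𝓕} _ (∈-++⁺ʳ (varsOf (lhs ρ)) (∈-++⁺ˡ x∈)))
    lhs-below : ∀ x → x ∈ xs → x < m
    lhs-below x x∈ = s≤s (≤-maxList {𝓕} _ (∈-++⁺ˡ (∈-deduplicate⁻ ℕ._≟_ (varsOf (lhs ρ)) x∈)))
    args-inst : interleave cs (substs (ns ++ᵥ varsVec xs) σ) ≡ substs (dupVars m csJ ++ᵥ varsVec xs) σJ
    args-inst = begin
      interleave cs (substs (ns ++ᵥ varsVec xs) σ)
        ≡⟨ cong (interleave cs) (substs-++ ns (varsVec xs) σ) ⟩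
      interleave cs (substs ns σ ++ᵥ substs (varsVec xs) σ)
        ≡⟨ interleave-++ cs _ _ ⟩
      interleaveConds cs (substs ns σ) ++ᵥ trs (substs (varsVec xs) σ)
        ≡⟨ cong₂ _++ᵥ_ (interleave-elim cs m σ σJ (splice-above m (tr ∘ σ) (condRhs cs)) (groundRhss normal Rρ))
                       (trs-varsVec xs σ σJ (λ x x∈ → splice-below m (tr ∘ σ) (condRhs cs) x (lhs-below x x∈))) ⟩
      substs (dupVars m csJ) σJ ++ᵥ substs (varsVec xs) σJ
        ≡⟨ sym (substs-++ (dupVars m csJ) (varsVec xs) σJ) ⟩
      substs (dupVars m csJ ++ᵥ varsVec xs) σJ ∎

  ruleSim : ∀ {l r} → UN R (l , r) → ∀ σ → RuleSim l r σ
  ruleSim (keep Rρ noConds) = keepSim Rρ noConds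
  ruleSim (intro Rρ hasConds) = introSim Rρ hasConds
  ruleSim (elim Rρ hasConds) = elimSim Rρ hasConds

  Covers : TermN {𝓕} → PosSet → PosSet → Set
  Covers s BN BJ = ∀ q → BN q → BJ (trPos s q)

  module StepSim {s p l r σ} (sim : RuleSim l r σ) (s|p : s at p ≡ just (l ⟨ σ ⟩)) where
    open RuleSim sim

    s′ : TermN {𝓕}
    s′ = s [ p ≔ r ⟨ σ ⟩ ]

    s′|p : s′ at p ≡ just (r ⟨ σ ⟩)
    s′|p = at-replace s p (l ⟨ σ ⟩) (r ⟨ σ ⟩) s|p

    redex : tr s at trPos s p ≡ just (lJ ⟨ σJ ⟩)
    redex = trans (tr-at s p) (trans (cong (mapMaybe tr) s|p) (cong just lhs-inst))

    contractum : tr s′ ≡ tr s [ trPos s p ≔ rJ ⟨ σJ ⟩ ]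
    contractum = trans (tr-replace s p (r ⟨ σ ⟩)) (cong (λ u → tr s [ trPos s p ≔ u ]) rhs-inst)

    covers-next : ∀ {BN BJ} → Covers s BN BJ → Covers s′ (nextB l r p BN) (nextB lJ rJ (trPos s p) BJ)
    covers-next {BJ = BJ} covers q (inj₁ (BNq , p⋠q)) =
      inj₁ ( subst BJ (sym untouched) (covers q BNq)
           , λ p≼q → p⋠q (trPos-reflects-≼ s p q (subst (trPos s p ≼_) untouched p≼q)))
      where
      untouched : trPos s′ q ≡ trPos s q
      untouched = trPos-replace-outside s p q (r ⟨ σ ⟩) p⋠q
    covers-next covers q (inj₂ (inj₁ (q′ , refl , rq′∈F))) =
      inj₂ (inj₁ (trPos r q′
        , trans (trPos-++ s′ p (r ⟨ σ ⟩) q′ s′|p)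
                (cong₂ _++_ (trPos-replace-at s p (r ⟨ σ ⟩)) (trPos-subst r q′ _ σ (proj₂ (proj₂ rq′∈F))))
        , subst (λ z → PosF z (trPos r q′)) (sym rhs-tr) (tr-PosF r q′ rq′∈F)))
    covers-next {BJ = BJ} covers q (inj₂ (inj₂ (p₁ , p′ , q′ , x , refl , BNpp₁q′ , l|p₁ , r|p′))) =
      inj₂ (inj₂ (trPos l p₁ , trPos r p′ , trPos (σ x) q′ , x
        , trans (trPos-through-var s′ p r σ p′ x q′ s′|p r|p′)
                (cong (_++ _) (trPos-replace-at s p (r ⟨ σ ⟩)))
        , subst BJ (trPos-through-var s p l σ p₁ x q′ s|p l|p₁) (covers _ BNpp₁q′)
        , lhs-vars p₁ x l|p₁
        , subst (λ z → z at trPos r p′ ≡ just (var x)) (sym rhs-tr)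
                (trans (tr-at r p′) (cong (mapMaybe tr) r|p′))))

  step-sim : ∀ {s t} → step (UN R) s t → step (UJ R′) (tr s) (tr t)
  step-sim {s} (p , l , r , σ , rule , s|p , refl) =
    trPos s p , lJ , rJ , σJ , isRule , redex , contractum
    where
    sim = ruleSim rule σ
    open RuleSim sim
    open StepSim {s = s} {p = p} sim s|p

  evs-sim : ∀ {BN s u} → EVSafe (UN R) BN s u → ∀ BJ → Covers s BN BJ → EVSafe (UJ R′) BJ (tr s) (tr u)
  evs-sim done BJ covers = done
  evs-sim {s = s} {u = u} (next p l r σ rule s|p BNp rest) BJ covers =
    next (trPos s p) lJ rJ σJ isRule redex (covers p BNp)
      (subst (λ z → EVSafe (UJ R′) (nextB lJ rJ (trPos s p) BJ) z (tr u)) contractum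
             (evs-sim rest _ (covers-next {BJ = BJ} covers)))
    where
    sim = ruleSim rule σ
    open RuleSim sim
    open StepSim {s = s} {p = p} sim s|p

  derivation-sim : ∀ {s t : Term 𝓕} → Star (step (UN R)) (emb s) (emb t) → Star (step (UJ R′)) (emb s) (emb t)
  derivation-sim {s} {t} st = subst₂ (Star (step (UJ R′))) (tr-emb s) (tr-emb t) (Star.gmap tr step-sim st)

  evs-derivation-sim : ∀ {s t : Term 𝓕} → evs (UN R) (emb s) (emb t) → evs (UJ R′) (emb s) (emb t)
  evs-derivation-sim {s} {t} st =
    subst₂ (EVSafe (UJ R′) (PosF (emb s))) (tr-emb s) (tr-emb t)
      (evs-sim st (PosF (emb s))
        (λ q q∈F → subst (λ z → PosF z (trPos (emb s) q)) (tr-emb s) (tr-PosF (emb s) q q∈F)))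

-- R'-steps are R-steps

module JoinToOriented {𝓕 : Signature} (R : CTRS 𝓕) (normal : NormalCTRS R) where

  R′ : CTRS 𝓕
  R′ = joinCTRS R

  -- An R_u-normal form has no →_{(i),R'}-reducts other than itself,
  -- since R' has the same left- and right-hand sides as R.
  normal-form-reducts : ∀ i {n u} → NormalForm (underlying R) n → Star (cstepN R′ i) n u → u ≡ n
  normal-form-reducts i nf ε = refl
  normal-form-reducts zero nf (() ◅ _)
  normal-form-reducts (suc i) nf ((p , ρ′ , σ , (ρ , Rρ , refl) , n|p , refl , _) ◅ _) =
    ⊥-elim (nf (_ , p , lhs ρ , rhs ρ , σ , (ρ , Rρ , refl , refl) , n|p , refl))

  join⇒reduces : ∀ i σ s n → varsOf n ≡ [] → NormalForm (underlying R) n →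
    holds (cstepN R′ i) σ (s ⇓ n) → Star (cstepN R′ i) (s ⟨ σ ⟩) (n ⟨ σ ⟩)
  join⇒reduces i σ s n ground nf (u , sσ→u , nσ→u) =
    subst (Star (cstepN R′ i) (s ⟨ σ ⟩)) (trans u≡n (sym nσ≡n)) sσ→u
    where
    nσ≡n : n ⟨ σ ⟩ ≡ n
    nσ≡n = subst-ground n σ ground
    u≡n : u ≡ n
    u≡n = normal-form-reducts i nf (subst (λ z → Star (cstepN R′ i) z u) nσ≡n nσ→u)

  stepN-join⇒oriented : ∀ i {s t} → cstepN R′ i s t → cstepN R i s t
  stepN-join⇒oriented zero ()
  stepN-join⇒oriented (suc i) (p , ρ′ , σ , (ρ , Rρ , refl) , s|p , t≡ , conds-hold) =
    p , ρ , σ , Rρ , s|p , t≡ , convert (normalConds normal Rρ) (map⁻ conds-hold)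
    where
    convert : ∀ {cs} → All (NormalCond R ρ) cs →
              All (holds (cstepN R′ i) σ ∘ toJoin) cs → All (holds (cstepN R i) σ) cs
    convert [] [] = []
    convert ((s , n , refl , _ , ground , nf) ∷ ncs) (joined ∷ hcs) =
      Star.map (stepN-join⇒oriented i) (join⇒reduces i σ s n ground nf joined) ∷ convert ncs hcs

  step-join⇒oriented : ∀ {s t} → cstep R′ s t → cstep R s t
  step-join⇒oriented (i , st) = i , stepN-join⇒oriented i st

theorem5p15 : (𝓕 : Signature) (R : CTRS 𝓕) → NormalCTRS R →
    (Sound arityJ UJ (joinCTRS R) → Sound arityN UN R)
    × (SoundEVS arityJ UJ (joinCTRS R) → SoundEVS arityN UN R)
theorem5p15 𝓕 R normal =
    (λ soundJ s t s→t → Star.map step-join⇒oriented (soundJ s t (derivation-sim s→t)))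
  , (λ soundJ s t s→t → Star.map step-join⇒oriented (soundJ s t (evs-derivation-sim s→t)))
  where
  open Simulation R normal
  open JoinToOriented R normal
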